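{- Let $\mathfrak{M}=(T,<,I,V)$ and $\mathfrak{M}'=(T',<',I',V')$ be models and $f$ a model p-morphism (in the sense for the language with $F$) from $\mathfrak{M}$ to $\mathfrak{M}'$. Then for every couple $(t,\pi)$ of $\mathfrak{M}$ and every formula $\varphi$ built from propositional variables with $\neg,\wedge,G,H,L,F$, $\mathfrak{M},(t,\pi)\models\varphi$ iff $\mathfrak{M}',f((t,\pi))\models\varphi$.
   Context: A tree is a pair $(T,<)$ with $<$ irreflexive, transitive and downward linear (if $b<a$ and $c<a$ then $b=c$, $b<c$ or $c<b$). A history is a $\subseteq$-maximal $<$-linear subset of $T$; $H_t$ is the set of histories containing $t$. An indistinguishability function assigns to each $t$ an equivalence relation $I_t$ on $H_t$ such that $hI_tk$ and $s<t$ imply $hI_sk$. $\Pi_t$ is the set of $I_t$-classes, $[h]_{I_s}$ the $I_s$-class of $h$. A model is $(T,<,I,V)$ with $(T,<)$ a tree, $I$ an indistinguishability function and $V$ mapping each propositional variable to a set of couples, couples being the elements of $\bigcup_{t\in T}(\{t\}\times\Pi_t)$. Satisfaction at $(t,\pi)$: $p$ iff $(t,\pi)\in V(p)$; Boolean clauses as usual; $G\varphi$ iff for each $h\in\pi$ and $s\in h$ with $t<s$, $\varphi$ holds at $(s,[h]_{I_s})$; $H\varphi$ iff for each $h\in\pi$ and $s\in h$ with $s<t$, $\varphi$ holds at $(s,[h]_{I_s})$; $L\varphi$ iff for each $\rho\in\Pi_t$, $\varphi$ holds at $(t,\rho)$; $F\varphi$ iff for each $h\in\pi$ there is $s\in h$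 with $t<s$ such that $\varphi$ holds at $(s,[h]_{I_s})$. On couples: $(t,\pi)\prec(s,\rho)$ iff $t<s$ and $\pi\supseteq\rho$; $\succ$ is the converse of $\prec$; $(t,\pi)\sim(s,\rho)$ iff $t=s$; primed versions in $\mathfrak{M}'$. For $f$ mapping couples to couples, write $f((t,\pi))=(f_1((t,\pi)),f_2((t,\pi)))$. A frame p-morphism (for the language with $F$) is a function $f$ from couples of $\mathfrak{M}$ to couples of $\mathfrak{M}'$ such that: (G-f) $(t,\pi)\prec(s,\rho)$ implies $f((t,\pi))\prec'f((s,\rho))$; (G-b) if $f((t,\pi))\prec'x'$ there is $(s,\rho)$ with $(t,\pi)\prec(s,\rho)$ and $f((s,\rho))=x'$; (H-b) if $f((t,\pi))\succ'x'$ there is $(s,\rho)$ with $(t,\pi)\succ(s,\rho)$ and $f((s,\rho))=x'$; (L-f) $(t,\pi)\sim(s,\rho)$ implies $f((t,\pi))\sim'f((s,\rho))$; (L-b) if $f((t,\pi))\sim'x'$ there is $(s,\rho)$ with $(t,\pi)\sim(s,\rho)$ and $f((s,\rho))=x'$; (F-f) for every couple $(t,\pi)$ and every $h'\in f_2((t,\pi))$ there is $h\in\pi$ such that for every $s\in h$ with $t<s$ there is $s'\in h'$ with $f_1((t,\pi))<'s'$ and $(s',[h']_{I'_{s'}})=f((s,[h]_{I_s}))$; (F-b) for every couple $(t,\pi)$ and every $h\in\pi$ there is $h'\in f_2((t,\pi))$ such that for every $s'\in h'$ with $f_1((t,\pi))<'s'$ there is $s\in h$ with $t<s$ and $f((s,[h]_{I_s}))=(s',[h']_{I'_{s'}})$.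 A model p-morphism is such a frame p-morphism satisfying (PV): for every couple $(t,\pi)$ and propositional variable $p$, $(t,\pi)\in V(p)$ iff $f((t,\pi))\in V'(p)$. -}

module Defs where

open import Level using (Lift)
open import Data.Nat using (ℕ)
open import Data.Product using (Σ; _×_; _,_; proj₁; proj₂)
open import Data.Sum using (_⊎_)
open import Data.Empty using (⊥)
open import Relation.Nullary using (¬_)
open import Relation.Binary.PropositionalEquality using (_≡_)

record Tree : Set₁ where
  field
    T          : Set
    _<_        : T → T → Set
    irrefl     : ∀ {a} → ¬ (a < a)
    trans      : ∀ {a b c} → a < b → b < c → a < c
    downLinear : ∀ {a b c} → b < a → c < a → (b ≡ c) ⊎ ((b < c) ⊎ (c < b))

module TreeNotions (𝒯 : Tree) where
  open Tree 𝒯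

  Subset : Set₁
  Subset = T → Set

  IsLinear : Subset → Set
  IsLinear X = ∀ x y → X x → X y → (x < y) ⊎ ((x ≡ y) ⊎ (y < x))

  IsHistory : Subset → Set₁
  IsHistory X = IsLinear X ×
    (∀ (Y : Subset) → IsLinear Y → (∀ x → X x → Y x) → ∀ x → Y x → X x)

  Hist : Set₁
  Hist = Σ Subset IsHistory

  _∈_ : T → Hist → Set
  t ∈ h = proj₁ h t

  _≐_ : Hist → Hist → Set
  h ≐ k = ∀ x → (x ∈ h → x ∈ k) × (x ∈ k → x ∈ h)

record IndistFun (𝒯 : Tree) : Set₁ where
  open Tree 𝒯
  open TreeNotions 𝒯
  field
    I       : T → Hist → Hist → Set
    I-dom   : ∀ {t h k} → I t h k → (t ∈ h) × (t ∈ k)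
    I-refl  : ∀ {t h} → t ∈ h → I t h h
    I-sym   : ∀ {t h k} → I t h k → I t k h
    I-trans : ∀ {t h k l} → I t h k → I t k l → I t h l
    I-mono  : ∀ {t s h k} → I t h k → s < t → I s h k
    -- histories are sets: extensionally equal histories are equal,
    -- hence I_t-related (automatic in set theory)
    I-ext   : ∀ {t h k} → t ∈ h → h ≐ k → I t h k

-- Couples (t , π) with π ∈ Π_t.  The class π is represented by any
-- history h ∈ H_t with π = [h]_{I_t}; two representations denote the
-- same couple iff they are related by _≈C_.

module CoupleNotions (𝒯 : Tree) (ℐ : IndistFun 𝒯) where
  open Tree 𝒯
  open TreeNotions 𝒯
  open IndistFun ℐ

  record Couple : Set₁ where
    constructor couple
    field
      time : T
      rep  : Hist
      time∈rep : time ∈ rep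

  open Couple public

  _∈π_ : Hist → Couple → Set
  k ∈π c = I (time c) (rep c) k

  _≈C_ : Couple → Couple → Set
  c ≈C d = (time c ≡ time d) × I (time c) (rep c) (rep d)

  _≺_ : Couple → Couple → Set₁
  c ≺ d = (time c < time d) × (∀ k → k ∈π d → k ∈π c)

  _≻_ : Couple → Couple → Set₁
  c ≻ d = d ≺ c

  _∼_ : Couple → Couple → Set
  c ∼ d = time c ≡ time d

record Model : Set₂ where
  field
    tree   : Tree
    indist : IndistFun tree
  open CoupleNotions tree indist
  field
    V      : ℕ → Couple → Set
    -- V(p) is a set of couples (so respects equality of couples)
    V-resp : ∀ {p c d} → c ≈C d → V p c → V p d

data Formula : Set where
  var  : ℕ → Formula
  ~_   : Formula → Formula
  _∧_  : Formula → Formula → Formula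
  G    : Formula → Formula
  H    : Formula → Formula
  L    : Formula → Formula
  F    : Formula → Formula

module Semantics (M : Model) where
  open Model M
  open Tree tree
  open TreeNotions tree
  open IndistFun indist
  open CoupleNotions tree indist

  _⊨_ : Couple → Formula → Set₁
  c ⊨ var p = Lift _ (V p c)
  c ⊨ (~ φ) = c ⊨ φ → ⊥
  c ⊨ (φ ∧ ψ) = (c ⊨ φ) × (c ⊨ ψ)
  couple t h _ ⊨ G φ =
    ∀ (k : Hist) → I t h k → ∀ s → (s∈k : s ∈ k) → t < s → couple s k s∈k ⊨ φ
  couple t h _ ⊨ H φ =
    ∀ (k : Hist) → I t h k → ∀ s → (s∈k : s ∈ k) → s < t → couple s k s∈k ⊨ φ
  couple t h _ ⊨ L φ =
    ∀ (k : Hist) → (t∈k : t ∈ k) → couple t k t∈k ⊨ φ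
  couple t h _ ⊨ F φ =
    ∀ (k : Hist) → I t h k →
      Σ T λ s → Σ (s ∈ k) λ s∈k → (t < s) × (couple s k s∈k ⊨ φ)

record FramePMorphism (M M′ : Model) : Set₂ where
  private
    module M  = Model M
    module M′ = Model M′
    module T  = Tree M.tree
    module T′ = Tree M′.tree
    module N  = TreeNotions M.tree
    module N′ = TreeNotions M′.tree
    module C  = CoupleNotions M.tree M.indist
    module C′ = CoupleNotions M′.tree M′.indist
  field
    f      : C.Couple → C′.Couple
    -- f is a function on couples (independent of representatives)
    f-resp : ∀ {c d} → c C.≈C d → f c C′.≈C f d
    G-f : ∀ {c d} → c C.≺ d → f c C′.≺ f d
    G-b : ∀ {c x′} → f c C′.≺ x′ → Σ C.Couple λ d → (c C.≺ d) × (f d C′.≈C x′)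
    H-b : ∀ {c x′} → f c C′.≻ x′ → Σ C.Couple λ d → (c C.≻ d) × (f d C′.≈C x′)
    L-f : ∀ {c d} → c C.∼ d → f c C′.∼ f d
    L-b : ∀ {c x′} → f c C′.∼ x′ → Σ C.Couple λ d → (c C.∼ d) × (f d C′.≈C x′)
    F-f : ∀ (c : C.Couple) (h′ : N′.Hist) → h′ C′.∈π f c →
      Σ N.Hist λ h → (h C.∈π c) ×
        (∀ s → (s∈h : s N.∈ h) → C.time c T.< s →
          Σ T′.T λ s′ → Σ (s′ N′.∈ h′) λ s′∈h′ →
            (C′.time (f c) T′.< s′) ×
            (C′.couple s′ h′ s′∈h′ C′.≈C f (C.couple s h s∈h)))
    F-b : ∀ (c : C.Couple) (h : N.Hist) → h C.∈π c →
      Σ N′.Hist λ h′ → (h′ C′.∈π f c) ×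
        (∀ s′ → (s′∈h′ : s′ N′.∈ h′) → C′.time (f c) T′.< s′ →
          Σ T.T λ s → Σ (s N.∈ h) λ s∈h →
            (C.time c T.< s) ×
            (f (C.couple s h s∈h) C′.≈C C′.couple s′ h′ s′∈h′))

record ModelPMorphism (M M′ : Model) : Set₂ where
  field
    frame : FramePMorphism M M′
  open FramePMorphism frame public
  field
    PV : ∀ c p → (Model.V M p c → Model.V M′ p (f c)) × (Model.V M′ p (f c) → Model.V M p c)

-- G, H and L are boxes over the relations ≺, ≻ and ∼ on couples, so they are
-- handled by the forth/back argument for bounded morphisms of Kripke frames.
-- F is not a box over a relation on couples (it quantifies over the histories
-- of the class π and then over their points), which is why (F-f) and (F-b) are
-- stated history by history; they are exactly what the F case needs.  Couples
-- are represented by histories, so every step holds up to _≈C_, which truth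
-- respects.
module Submission where

open import Level using (Level; lift)
open import Data.Product using (Σ; _×_; _,_; proj₁; proj₂)
open import Function using (_∘_)
open import Function.Bundles using (_⇔_; mk⇔; Equivalence)
open import Relation.Binary.PropositionalEquality using (refl)
open import Defs

open Equivalence using (to; from)

module _ {a b r r′ p p′ : Level} {A : Set a} {B : Set b} (f : A → B)
         (R : A → A → Set r) (R′ : B → B → Set r′)
         {P : A → Set p} {P′ : B → Set p′} where

  □-preserved : ∀ {e} {_≈_ : B → B → Set e} → (∀ {x y} → x ≈ y → P′ x → P′ y) →
    ∀ c → (∀ {x′} → R′ (f c) x′ → Σ A λ d → R c d × (f d ≈ x′)) →
    (∀ d → P d → P′ (f d)) →
    (∀ d → R c d → P d) → ∀ x′ → R′ (f c) x′ → P′ x′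
  □-preserved P′-resp c back P⇒P′ □P x′ cR′x′ with back cR′x′
  ... | d , cRd , fd≈x′ = P′-resp fd≈x′ (P⇒P′ d (□P d cRd))

  □-reflected : ∀ c → (∀ {d} → R c d → R′ (f c) (f d)) →
    (∀ d → P′ (f d) → P d) →
    (∀ x′ → R′ (f c) x′ → P′ x′) → ∀ d → R c d → P d
  □-reflected c forth P′⇒P □P′ d cRd = P′⇒P d (□P′ (f d) (forth cRd))

module ModalSemantics (M : Model) where
  open Model M
  open IndistFun indist
  open CoupleNotions tree indist
  open Semantics M

  ≈C-sym : ∀ {c d} → c ≈C d → d ≈C c
  ≈C-sym (refl , i) = refl , I-sym i

  ⊨-resp-≈C : ∀ φ {c d} → c ≈C d → c ⊨ φ → d ⊨ φ
  ⊨-resp-≈C (var p) {c} {d} c≈d (lift v) = lift (V-resp {p} {c} {d} c≈d v)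
  ⊨-resp-≈C (~ φ)   {c} {d} c≈d ¬c⊨φ d⊨φ =
    ¬c⊨φ (⊨-resp-≈C φ {d} {c} (≈C-sym {c} {d} c≈d) d⊨φ)
  ⊨-resp-≈C (φ ∧ ψ) c≈d (c⊨φ , c⊨ψ)     = ⊨-resp-≈C φ c≈d c⊨φ , ⊨-resp-≈C ψ c≈d c⊨ψ
  ⊨-resp-≈C (G φ)   (refl , i) c⊨Gφ k ik = c⊨Gφ k (I-trans i ik)
  ⊨-resp-≈C (H φ)   (refl , i) c⊨Hφ k ik = c⊨Hφ k (I-trans i ik)
  ⊨-resp-≈C (L φ)   (refl , i) c⊨Lφ      = c⊨Lφ
  ⊨-resp-≈C (F φ)   (refl , i) c⊨Fφ k ik = c⊨Fφ k (I-trans i ik)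

  G-as-□ : ∀ c φ → c ⊨ G φ ⇔ (∀ d → c ≺ d → d ⊨ φ)
  G-as-□ (couple t h _) φ = mk⇔
    (λ c⊨Gφ (couple s k s∈k) (t<s , ρ⊆π) → c⊨Gφ k (ρ⊆π k (I-refl s∈k)) s s∈k t<s)
    (λ □φ k ik s s∈k t<s →
      □φ (couple s k s∈k) (t<s , λ j ij → I-trans ik (I-mono ij t<s)))

  -- A predecessor (s , ρ) of (t , π) has h ∈ ρ for the representative h of π,
  -- so it is the couple (s , [h]) that the clause for H speaks about.
  H-as-□ : ∀ c φ → c ⊨ H φ ⇔ (∀ d → c ≻ d → d ⊨ φ)
  H-as-□ (couple t h t∈h) φ = mk⇔
    (λ c⊨Hφ (couple s k s∈k) (s<t , π⊆ρ) →
      let h∈ρ = π⊆ρ h (I-refl t∈h)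
          s∈h = proj₂ (I-dom h∈ρ)
      in ⊨-resp-≈C φ (refl , I-sym h∈ρ) (c⊨Hφ h (I-refl t∈h) s s∈h s<t))
    (λ □φ k ik s s∈k s<t →
      □φ (couple s k s∈k) (s<t , λ j ij → I-mono (I-trans (I-sym ik) ij) s<t))

  L-as-□ : ∀ c φ → c ⊨ L φ ⇔ (∀ d → c ∼ d → d ⊨ φ)
  L-as-□ (couple t h _) φ = mk⇔
    (λ { c⊨Lφ (couple .t k t∈k) refl → c⊨Lφ k t∈k })
    (λ □φ k t∈k → □φ (couple t k t∈k) refl)

module PMorphismInvariance (M M′ : Model) (m : ModelPMorphism M M′) where
  open ModelPMorphism m
  open CoupleNotions (Model.tree M) (Model.indist M)
  open CoupleNotions (Model.tree M′) (Model.indist M′)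
    using () renaming (couple to couple′; _≺_ to _≺′_; _≻_ to _≻′_; _∼_ to _∼′_)
  open Semantics M
  open Semantics M′ renaming (_⊨_ to _⊨′_)
  open ModalSemantics M
  open ModalSemantics M′ renaming (≈C-sym to ≈C′-sym; ⊨-resp-≈C to ⊨′-resp-≈C;
    G-as-□ to G-as-□′; H-as-□ to H-as-□′; L-as-□ to L-as-□′)

  preserves : ∀ φ c → c ⊨ φ → f c ⊨′ φ
  reflects  : ∀ φ c → f c ⊨′ φ → c ⊨ φ

  preserves (var p) c (lift v) = lift (proj₁ (PV c p) v)
  preserves (~ φ) c ¬c⊨φ fc⊨φ = ¬c⊨φ (reflects φ c fc⊨φ)
  preserves (φ ∧ ψ) c (c⊨φ , c⊨ψ) = preserves φ c c⊨φ , preserves ψ c c⊨ψ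
  preserves (G φ) c =
    from (G-as-□′ (f c) φ)
    ∘ □-preserved f _≺_ _≺′_ (⊨′-resp-≈C φ) c (λ {x′} → G-b {c} {x′}) (preserves φ)
    ∘ to (G-as-□ c φ)
  preserves (H φ) c =
    from (H-as-□′ (f c) φ)
    ∘ □-preserved f _≻_ _≻′_ (⊨′-resp-≈C φ) c (λ {x′} → H-b {c} {x′}) (preserves φ)
    ∘ to (H-as-□ c φ)
  preserves (L φ) c =
    from (L-as-□′ (f c) φ)
    ∘ □-preserved f _∼_ _∼′_ (⊨′-resp-≈C φ) c (λ {x′} → L-b {c} {x′}) (preserves φ)
    ∘ to (L-as-□ c φ)
  preserves (F φ) c c⊨Fφ k′ k′∈fc with F-f c k′ k′∈fc
  ... | k , k∈c , k′-follows-k with c⊨Fφ k k∈c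
  ... | s , s∈k , t<s , s⊨φ with k′-follows-k s s∈k t<s
  ... | s′ , s′∈k′ , fc<s′ , s′≈fs =
    s′ , s′∈k′ , fc<s′ ,
    ⊨′-resp-≈C φ (≈C′-sym {couple′ s′ k′ s′∈k′} {f (couple s k s∈k)} s′≈fs)
      (preserves φ (couple s k s∈k) s⊨φ)

  reflects (var p) c (lift v) = lift (proj₂ (PV c p) v)
  reflects (~ φ) c ¬fc⊨φ c⊨φ = ¬fc⊨φ (preserves φ c c⊨φ)
  reflects (φ ∧ ψ) c (fc⊨φ , fc⊨ψ) = reflects φ c fc⊨φ , reflects ψ c fc⊨ψ
  reflects (G φ) c =
    from (G-as-□ c φ)
    ∘ □-reflected f _≺_ _≺′_ c (λ {d} → G-f {c} {d}) (reflects φ)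
    ∘ to (G-as-□′ (f c) φ)
  reflects (H φ) c =
    from (H-as-□ c φ)
    ∘ □-reflected f _≻_ _≻′_ c (λ {d} → G-f {d} {c}) (reflects φ)
    ∘ to (H-as-□′ (f c) φ)
  reflects (L φ) c =
    from (L-as-□ c φ)
    ∘ □-reflected f _∼_ _∼′_ c (λ {d} → L-f {c} {d}) (reflects φ)
    ∘ to (L-as-□′ (f c) φ)
  reflects (F φ) c fc⊨Fφ k k∈c with F-b c k k∈c
  ... | k′ , k′∈fc , k-follows-k′ with fc⊨Fφ k′ k′∈fc
  ... | s′ , s′∈k′ , fc<s′ , s′⊨φ with k-follows-k′ s′ s′∈k′ fc<s′
  ... | s , s∈k , t<s , fs≈s′ =
    s , s∈k , t<s ,
    reflects φ (couple s k s∈k)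
      (⊨′-resp-≈C φ (≈C′-sym {f (couple s k s∈k)} {couple′ s′ k′ s′∈k′} fs≈s′) s′⊨φ)

mainTheorem6 : (M M′ : Model) (m : ModelPMorphism M M′) →
    ∀ (c : CoupleNotions.Couple (Model.tree M) (Model.indist M)) (φ : Formula) →
    Semantics._⊨_ M c φ ⇔ Semantics._⊨_ M′ (ModelPMorphism.f m c) φ
mainTheorem6 M M′ m c φ = mk⇔ (preserves φ c) (reflects φ c)
  where open PMorphismInvariance M M′ m
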